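{- Let $\mathcal Q$ be a unital quantale with underlying set $A$, let $\mathcal S\subseteq\mathcal Q$ be a subquantale, and let $I_{\mathcal S}(a)=\bigvee\{s\in\mathcal S\mid s\le a\}$. Then $\langle\mathcal Q,I_{\mathcal S}\rangle$ is isomorphic to some relational quantale on $A$ equipped with some quantic conucleus $\hat I$; that is, there is a quantale isomorphism $\varphi$ from $\mathcal Q$ onto a relational quantale on $A$ with $\varphi(I_{\mathcal S}a)=\hat I(\varphi(a))$ for all $a$.
   Context: A quantale is a complete join-semilattice with an associative multiplication distributing over arbitrary joins on both sides; unital if it has a unit $\varepsilon$. A subquantale is a subset closed under multiplication and arbitrary joins. A quantic conucleus on a quantale is a map $I$ with $Ia\le a$, $I(Ia)=Ia$, $a\le b\Rightarrow Ia\le Ib$, and $Ia\cdot Ib=I(Ia\cdot Ib)$. A relational quantale on a set $A$ is a family $\mathcal R$ of binary relations on $A$ which, ordered by inclusion, is a complete lattice (with join $\bigvee$), is closed under relational composition $R\circ S=\{\langle a,c\rangle\mid\exists b\,(\langle a,b\rangle\in R,\langle b,c\rangle\in S)\}$, contains a neutral element for $\circ$, and in which $\circ$ distributes over arbitrary $\bigvee$ on both sides. -}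

module Defs where

open import Level using (Level; _⊔_; suc)
open import Data.Product using (Σ; Σ-syntax; ∃; _×_; _,_; proj₁; proj₂)
open import Relation.Binary.Core using (Rel)
open import Relation.Binary.Structures using (IsPartialOrder)

record Quantale (c e i : Level) : Set (suc (c ⊔ e ⊔ i)) where
  infixl 7 _·_
  infix 4 _≈_ _≤_
  field
    Carrier        : Set c
    _≈_            : Rel Carrier e
    _≤_            : Rel Carrier e
    isPartialOrder : IsPartialOrder _≈_ _≤_
    ⋁              : {I : Set i} → (I → Carrier) → Carrier
    ⋁-upper        : {I : Set i} (f : I → Carrier) (j : I) → f j ≤ ⋁ f
    ⋁-least        : {I : Set i} (f : I → Carrier) (b : Carrier) →
                     ((j : I) → f j ≤ b) → ⋁ f ≤ b
    _·_            : Carrier → Carrier → Carrier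
    ·-cong         : ∀ {a a′ b b′} → a ≈ a′ → b ≈ b′ → a · b ≈ a′ · b′
    ·-assoc        : ∀ a b c → (a · b) · c ≈ a · (b · c)
    ·-distribˡ-⋁   : ∀ a {I : Set i} (f : I → Carrier) →
                     a · ⋁ f ≈ ⋁ (λ j → a · f j)
    ·-distribʳ-⋁   : ∀ a {I : Set i} (f : I → Carrier) →
                     ⋁ f · a ≈ ⋁ (λ j → f j · a)

record UnitalQuantale (c e i : Level) : Set (suc (c ⊔ e ⊔ i)) where
  field
    quantale : Quantale c e i
  open Quantale quantale public
  field
    ε        : Carrier
    ·-identityˡ : ∀ a → ε · a ≈ a
    ·-identityʳ : ∀ a → a · ε ≈ a

record Subquantale {c e i} (Q : Quantale c e i) (s : Level)
       : Set (suc s ⊔ c ⊔ e ⊔ suc i) where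
  open Quantale Q
  field
    member   : Carrier → Set s
    ·-closed : ∀ {a b} → member a → member b → member (a · b)
    ⋁-closed : {I : Set i} (f : I → Carrier) →
               ((j : I) → member (f j)) → member (⋁ f)

interiorOf : ∀ {ℓ} {Q : Quantale ℓ ℓ ℓ} → Subquantale Q ℓ →
             Quantale.Carrier Q → Quantale.Carrier Q
interiorOf {Q = Q} S a =
  ⋁ {Σ[ s ∈ Carrier ] (member s × s ≤ a)} proj₁
  where open Quantale Q
        open Subquantale S

record IsQuanticConucleus {c e i} (Q : Quantale c e i)
       (I : Quantale.Carrier Q → Quantale.Carrier Q) : Set (c ⊔ e) where
  open Quantale Q
  field
    deflationary : ∀ a → I a ≤ a
    idempotent   : ∀ a → I (I a) ≈ I a
    monotone     : ∀ {a b} → a ≤ b → I a ≤ I b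
    multiplicative : ∀ a b → I a · I b ≈ I (I a · I b)

record IsQuantaleIso {c₁ e₁ c₂ e₂ i} (Q₁ : Quantale c₁ e₁ i) (Q₂ : Quantale c₂ e₂ i)
       (φ : Quantale.Carrier Q₁ → Quantale.Carrier Q₂)
       : Set (c₁ ⊔ e₁ ⊔ c₂ ⊔ e₂ ⊔ suc i) where
  module Q₁ = Quantale Q₁
  module Q₂ = Quantale Q₂
  field
    cong       : ∀ {a b} → a Q₁.≈ b → φ a Q₂.≈ φ b
    injective  : ∀ {a b} → φ a Q₂.≈ φ b → a Q₁.≈ b
    surjective : ∀ y → Σ[ a ∈ Q₁.Carrier ] (φ a Q₂.≈ y)
    pres-·     : ∀ a b → φ (a Q₁.· b) Q₂.≈ (φ a Q₂.· φ b)
    pres-⋁     : {I : Set i} (f : I → Q₁.Carrier) →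
                 φ (Q₁.⋁ f) Q₂.≈ Q₂.⋁ (λ j → φ (f j))

module _ {ℓ} {A : Set ℓ} where

  infix 4 _⊆ᴿ_ _≐_
  _⊆ᴿ_ : Rel A ℓ → Rel A ℓ → Set ℓ
  R ⊆ᴿ S = ∀ x y → R x y → S x y

  _≐_ : Rel A ℓ → Rel A ℓ → Set ℓ
  R ≐ S = (R ⊆ᴿ S) × (S ⊆ᴿ R)

  infixl 7 _∘ᴿ_
  _∘ᴿ_ : Rel A ℓ → Rel A ℓ → Rel A ℓ
  (R ∘ᴿ S) a c = ∃ λ b → R a b × S b c

record RelationalQuantale {ℓ} (A : Set ℓ) : Set (suc ℓ) where
  field
    ℛ : Rel A ℓ → Set ℓ
  Elem : Set (suc ℓ)
  Elem = Σ (Rel A ℓ) ℛ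
  field
    ⋁ᴿ       : {I : Set ℓ} → (I → Elem) → Rel A ℓ
    ⋁ᴿ-in    : {I : Set ℓ} (f : I → Elem) → ℛ (⋁ᴿ f)
    ⋁ᴿ-upper : {I : Set ℓ} (f : I → Elem) (j : I) → proj₁ (f j) ⊆ᴿ ⋁ᴿ f
    ⋁ᴿ-least : {I : Set ℓ} (f : I → Elem) (T : Elem) →
               ((j : I) → proj₁ (f j) ⊆ᴿ proj₁ T) → ⋁ᴿ f ⊆ᴿ proj₁ T
    ∘-closed : ∀ {R S} → ℛ R → ℛ S → ℛ (R ∘ᴿ S)
    E        : Rel A ℓ
    E-in     : ℛ E
    E-identityˡ : ∀ {R} → ℛ R → (E ∘ᴿ R) ≐ R
    E-identityʳ : ∀ {R} → ℛ R → (R ∘ᴿ E) ≐ R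

  _∘ₑ_ : Elem → Elem → Elem
  (R , r) ∘ₑ (S , s) = (R ∘ᴿ S) , ∘-closed r s

  field
    ∘-distribˡ-⋁ : (R : Elem) {I : Set ℓ} (f : I → Elem) →
                   (proj₁ R ∘ᴿ ⋁ᴿ f) ≐ ⋁ᴿ (λ j → R ∘ₑ f j)
    ∘-distribʳ-⋁ : (R : Elem) {I : Set ℓ} (f : I → Elem) →
                   (⋁ᴿ f ∘ᴿ proj₁ R) ≐ ⋁ᴿ (λ j → f j ∘ₑ R)

module _ {ℓ} {A : Set ℓ} (RQ : RelationalQuantale A) where
  open RelationalQuantale RQ

  private
    ≈-isPO : IsPartialOrder {A = Elem} (λ R S → proj₁ R ≐ proj₁ S)
                                        (λ R S → proj₁ R ⊆ᴿ proj₁ S)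
    ≈-isPO = record
      { isPreorder = record
        { isEquivalence = record
          { refl  = (λ _ _ p → p) , (λ _ _ p → p)
          ; sym   = λ { (p , q) → q , p }
          ; trans = λ { (p , q) (p′ , q′) →
                        (λ x y r → p′ x y (p x y r)) , (λ x y r → q x y (q′ x y r)) } }
        ; reflexive = proj₁
        ; trans = λ p q x y r → q x y (p x y r) }
      ; antisym = _,_ }

  asQuantale : Quantale (suc ℓ) ℓ ℓ
  asQuantale = record
    { Carrier = Elem
    ; _≈_ = λ R S → proj₁ R ≐ proj₁ S
    ; _≤_ = λ R S → proj₁ R ⊆ᴿ proj₁ S
    ; isPartialOrder = ≈-isPO
    ; ⋁ = λ f → ⋁ᴿ f , ⋁ᴿ-in f
    ; ⋁-upper = ⋁ᴿ-upper
    ; ⋁-least = ⋁ᴿ-least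
    ; _·_ = _∘ₑ_
    ; ·-cong = λ { (p , q) (p′ , q′) →
        (λ { x z (y , r , s) → y , p x y r , p′ y z s }) ,
        (λ { x z (y , r , s) → y , q x y r , q′ y z s }) }
    ; ·-assoc = λ _ _ _ →
        (λ { x w (z , (y , r , s) , t) → y , r , z , s , t }) ,
        (λ { x w (y , r , z , s , t) → z , (y , r , s) , t })
    ; ·-distribˡ-⋁ = ∘-distribˡ-⋁
    ; ·-distribʳ-⋁ = ∘-distribʳ-⋁
    }

-- Cayley representation: an element a of a unital quantale acts on the carrier A
-- as the relation x ↦ y iff x ≤ a · y.  The unit makes a ↦ this relation an order
-- embedding, associativity turns · into relational composition, and the relations
-- of this form carry the joins of Q.  Any quantic conucleus on Q, in particular
-- the interior operator of a subquantale, is then transported along the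
-- isomorphism to one on the relational quantale.
module Submission where

open import Defs
open import Level using (Level; Lift; lift)
open import Data.Bool using (Bool; true; false)
open import Data.Product using (Σ; Σ-syntax; _×_; _,_; proj₁; proj₂)
open import Relation.Binary.Core using (Rel)
open import Relation.Binary.Structures using (IsPartialOrder)

module QuantaleProperties {c e i} (Q : Quantale c e i) where
  open Quantale Q
  open IsPartialOrder isPartialOrder

  -- a ≤ b means b is the join of the two-element family a, b; distributivity
  -- over that join gives monotonicity of ·.
  private
    pair : Carrier → Carrier → Lift i Bool → Carrier
    pair a b (lift true)  = a
    pair a b (lift false) = b

    ⋁-pair : ∀ {a b} → a ≤ b → ⋁ (pair a b) ≈ b
    ⋁-pair {a} {b} a≤b =
      antisym (⋁-least _ b λ { (lift true) → a≤b ; (lift false) → refl })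
              (⋁-upper (pair a b) (lift false))

  ·-monoˡ : ∀ {a b} c → a ≤ b → a · c ≤ b · c
  ·-monoˡ {a} {b} c a≤b =
    ≤-respʳ-≈ (·-cong (⋁-pair a≤b) Eq.refl)
      (≤-respʳ-≈ (Eq.sym (·-distribʳ-⋁ c (pair a b)))
        (⋁-upper (λ j → pair a b j · c) (lift true)))

  ·-monoʳ : ∀ {a b} c → a ≤ b → c · a ≤ c · b
  ·-monoʳ {a} {b} c a≤b =
    ≤-respʳ-≈ (·-cong Eq.refl (⋁-pair a≤b))
      (≤-respʳ-≈ (Eq.sym (·-distribˡ-⋁ c (pair a b)))
        (⋁-upper (λ j → c · pair a b j) (lift true)))

module RelationProperties {ℓ} {A : Set ℓ} where

  ≐-refl : {R : Rel A ℓ} → R ≐ R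
  ≐-refl = (λ _ _ r → r) , (λ _ _ r → r)

  ≐-sym : {R T : Rel A ℓ} → R ≐ T → T ≐ R
  ≐-sym (R⊆T , T⊆R) = T⊆R , R⊆T

  ≐-trans : {R T U : Rel A ℓ} → R ≐ T → T ≐ U → R ≐ U
  ≐-trans (R⊆T , T⊆R) (T⊆U , U⊆T) =
    (λ x y r → T⊆U x y (R⊆T x y r)) , (λ x y u → T⊆R x y (U⊆T x y u))

  ∘ᴿ-cong : {R R′ T T′ : Rel A ℓ} → R ≐ R′ → T ≐ T′ → (R ∘ᴿ T) ≐ (R′ ∘ᴿ T′)
  ∘ᴿ-cong (R⊆R′ , R′⊆R) (T⊆T′ , T′⊆T) =
    (λ { x z (y , r , t) → y , R⊆R′ x y r , T⊆T′ y z t }) ,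
    (λ { x z (y , r , t) → y , R′⊆R x y r , T′⊆T y z t })

module Interior {ℓ} {Q : Quantale ℓ ℓ ℓ} (S : Subquantale Q ℓ) where
  open Quantale Q
  open IsPartialOrder isPartialOrder
  open Subquantale S

  interior-member : ∀ a → member (interiorOf S a)
  interior-member a = ⋁-closed proj₁ λ j → proj₁ (proj₂ j)

  interior-fixes-member : ∀ {s} → member s → interiorOf S s ≈ s
  interior-fixes-member {s} s∈S =
    antisym (⋁-least _ s λ j → proj₂ (proj₂ j)) (⋁-upper proj₁ (s , s∈S , refl))

  interior-isQuanticConucleus : IsQuanticConucleus Q (interiorOf S)
  interior-isQuanticConucleus = record
    { deflationary   = λ a → ⋁-least _ a λ j → proj₂ (proj₂ j)
    ; idempotent     = λ a → interior-fixes-member (interior-member a)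
    ; monotone       = λ a≤b →
        ⋁-least _ _ λ { (s , s∈S , s≤a) → ⋁-upper proj₁ (s , s∈S , trans s≤a a≤b) }
    ; multiplicative = λ a b →
        Eq.sym (interior-fixes-member (·-closed (interior-member a) (interior-member b)))
    }

module Cayley {ℓ} (Q : UnitalQuantale ℓ ℓ ℓ) where
  open UnitalQuantale Q
  open IsPartialOrder isPartialOrder
  open QuantaleProperties quantale
  open RelationProperties {A = Carrier}

  cayley : Carrier → Rel Carrier ℓ
  cayley a x y = x ≤ a · y

  cayley-mono : ∀ {a b} → a ≤ b → cayley a ⊆ᴿ cayley b
  cayley-mono a≤b x y x≤ay = trans x≤ay (·-monoˡ y a≤b)

  cayley-cong : ∀ {a b} → a ≈ b → cayley a ≐ cayley b
  cayley-cong a≈b = cayley-mono (reflexive a≈b) , cayley-mono (reflexive (Eq.sym a≈b))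

  -- Evaluate the inclusion at ⟨a , ε⟩.
  cayley-reflects-≤ : ∀ {a b} → cayley a ⊆ᴿ cayley b → a ≤ b
  cayley-reflects-≤ {a} {b} a⊆b =
    ≤-respʳ-≈ (·-identityʳ b) (a⊆b a ε (reflexive (Eq.sym (·-identityʳ a))))

  cayley-∘ : ∀ a b → (cayley a ∘ᴿ cayley b) ≐ cayley (a · b)
  cayley-∘ a b =
    (λ { x z (y , x≤ay , y≤bz) →
           ≤-respʳ-≈ (Eq.sym (·-assoc a b z)) (trans x≤ay (·-monoʳ a y≤bz)) }) ,
    (λ x z x≤abz → b · z , ≤-respʳ-≈ (·-assoc a b z) x≤abz , refl)

  IsCayley : Rel Carrier ℓ → Set ℓ
  IsCayley R = Σ[ a ∈ Carrier ] (R ≐ cayley a)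

  Cayley : Set (Level.suc ℓ)
  Cayley = Σ (Rel Carrier ℓ) IsCayley

  representative : Cayley → Carrier
  representative R = proj₁ (proj₂ R)

  representative-spec : (R : Cayley) → proj₁ R ≐ cayley (representative R)
  representative-spec R = proj₂ (proj₂ R)

  representative-mono : (R T : Cayley) → proj₁ R ⊆ᴿ proj₁ T →
                        representative R ≤ representative T
  representative-mono R T R⊆T = cayley-reflects-≤ λ x y r →
    proj₁ (representative-spec T) x y (R⊆T x y (proj₂ (representative-spec R) x y r))

  ∘ᴿ-isCayley : ∀ {R T} → IsCayley R → IsCayley T → IsCayley (R ∘ᴿ T)
  ∘ᴿ-isCayley (a , R≐a) (b , T≐b) = a · b , ≐-trans (∘ᴿ-cong R≐a T≐b) (cayley-∘ a b)

  ε-∘ᴿ : ∀ {R} → IsCayley R → (cayley ε ∘ᴿ R) ≐ R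
  ε-∘ᴿ (a , R≐a) =
    ≐-trans (∘ᴿ-cong ≐-refl R≐a) (≐-trans (cayley-∘ ε a)
      (≐-trans (cayley-cong (·-identityˡ a)) (≐-sym R≐a)))

  ∘ᴿ-ε : ∀ {R} → IsCayley R → (R ∘ᴿ cayley ε) ≐ R
  ∘ᴿ-ε (a , R≐a) =
    ≐-trans (∘ᴿ-cong R≐a ≐-refl) (≐-trans (cayley-∘ a ε)
      (≐-trans (cayley-cong (·-identityʳ a)) (≐-sym R≐a)))

  ⋁ᶜ : {I : Set ℓ} → (I → Cayley) → Rel Carrier ℓ
  ⋁ᶜ f = cayley (⋁ (λ j → representative (f j)))

  cayleyRelationalQuantale : RelationalQuantale Carrier
  cayleyRelationalQuantale = record
    { ℛ           = IsCayley
    ; ⋁ᴿ          = ⋁ᶜ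
    ; ⋁ᴿ-in       = λ f → _ , ≐-refl
    ; ⋁ᴿ-upper    = λ f j x y r →
        cayley-mono (⋁-upper _ j) x y (proj₁ (representative-spec (f j)) x y r)
    ; ⋁ᴿ-least    = λ f T fⱼ⊆T x y r →
        proj₂ (representative-spec T) x y
          (cayley-mono (⋁-least _ _ λ j → representative-mono (f j) T (fⱼ⊆T j)) x y r)
    ; ∘-closed    = ∘ᴿ-isCayley
    ; E           = cayley ε
    ; E-in        = ε , ≐-refl
    ; E-identityˡ = ε-∘ᴿ
    ; E-identityʳ = ∘ᴿ-ε
    ; ∘-distribˡ-⋁ = λ R f →
        ≐-trans (∘ᴿ-cong (representative-spec R) ≐-refl)
          (≐-trans (cayley-∘ _ _) (cayley-cong (·-distribˡ-⋁ (representative R) _)))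
    ; ∘-distribʳ-⋁ = λ R f →
        ≐-trans (∘ᴿ-cong ≐-refl (representative-spec R))
          (≐-trans (cayley-∘ _ _) (cayley-cong (·-distribʳ-⋁ (representative R) _)))
    }

  toCayley : Carrier → Cayley
  toCayley a = cayley a , a , ≐-refl

  toCayley-isQuantaleIso : IsQuantaleIso quantale (asQuantale cayleyRelationalQuantale) toCayley
  toCayley-isQuantaleIso = record
    { cong       = cayley-cong
    ; injective  = λ (a⊆b , b⊆a) → antisym (cayley-reflects-≤ a⊆b) (cayley-reflects-≤ b⊆a)
    ; surjective = λ R → representative R , ≐-sym (representative-spec R)
    ; pres-·     = λ a b → ≐-sym (cayley-∘ a b)
    ; pres-⋁     = λ f → ≐-refl
    }

  transport : (Carrier → Carrier) → Cayley → Cayley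
  transport I R = toCayley (I (representative R))

  -- The representative of a composite is the product of representatives
  -- definitionally, so multiplicativity transfers without rewriting.
  transport-isQuanticConucleus : ∀ {I} → IsQuanticConucleus quantale I →
    IsQuanticConucleus (asQuantale cayleyRelationalQuantale) (transport I)
  transport-isQuanticConucleus isConucleus = record
    { deflationary   = λ R x y r →
        proj₂ (representative-spec R) x y (cayley-mono (deflationary _) x y r)
    ; idempotent     = λ R → cayley-cong (idempotent _)
    ; monotone       = λ {R} {T} R⊆T → cayley-mono (monotone (representative-mono R T R⊆T))
    ; multiplicative = λ R T → ≐-trans (cayley-∘ _ _) (cayley-cong (multiplicative _ _))
    }
    where open IsQuanticConucleus isConucleus

mainTheorem3 : ∀ {ℓ : Level} (Q : UnitalQuantale ℓ ℓ ℓ)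
                 (S : Subquantale (UnitalQuantale.quantale Q) ℓ) →
                 Σ[ RQ ∈ RelationalQuantale (UnitalQuantale.Carrier Q) ]
                 Σ[ Î ∈ (Quantale.Carrier (asQuantale RQ) → Quantale.Carrier (asQuantale RQ)) ]
                 Σ[ φ ∈ (UnitalQuantale.Carrier Q → Quantale.Carrier (asQuantale RQ)) ]
                 (IsQuanticConucleus (asQuantale RQ) Î
                 × IsQuantaleIso (UnitalQuantale.quantale Q) (asQuantale RQ) φ
                 × (∀ a → Quantale._≈_ (asQuantale RQ) (φ (interiorOf S a)) (Î (φ a))))
mainTheorem3 Q S =
  cayleyRelationalQuantale , transport (interiorOf S) , toCayley ,
  transport-isQuanticConucleus (interior-isQuanticConucleus S) ,
  toCayley-isQuantaleIso ,
  λ a → ≐-refl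
  where
    open Cayley Q
    open Interior using (interior-isQuanticConucleus)
    open RelationProperties using (≐-refl)
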